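{- Let $n \ge 1$ be an integer. Then: (i) $K^{\mathbf u}(n)$ has no balanced circuits; (ii) the balanced circuits of $K^{\mathbf o}(n)$ are precisely the oscillating circuits of $K_n$ (with the usual ordering of $[n]$); and (iii) for every integer $a \ge 0$, the balanced circuits of $K^a(n)$ are precisely the circuits $C$ of $K_n$ for which $a \mid \delta(C)$. In particular, (i) and (ii) hold for every admissible choice of $\Gamma$, $S$ and the labellings in the definitions of $K^{\mathbf u}(n)$ and $K^{\mathbf o}(n)$.
   Context: Let $K_n$ have vertex set $[n]$ with the usual order, and let $\vec{K_n}$ orient each edge $ij$ with $i<j$ from $i$ to $j$. For a group $\Gamma$ and $\gamma\colon E(K_n)\to\Gamma$, a circuit with vertices $v_1,\dots,v_k$ and edges $e_i=v_iv_{i+1}$ ($v_{k+1}=v_1$) is balanced if $\prod_{i=1}^k\gamma'(e_i)$ is the identity, where $\gamma'(e_i)=\gamma(e_i)$ if $e_i$ is oriented from $v_i$ to $v_{i+1}$ and $\gamma(e_i)^{ -1}$ otherwise; the biased graph of $(\vec{K_n},\gamma)$ is $K_n$ together with its set of balanced circuits. Let $m=\binom n2$, $\Gamma$ a cyclic group of order at least $2^m$, and $S\subseteq\Gamma$ with $|S|=m$ such that no two distinct subsets of $S$ have the same product. $K^{\mathbf u}(n)$ is the biased graph of $(\vec{K_n},\gamma^{\mathbf u})$, where $\gamma^{\mathbf u}$ assigns distinct elements of $S$ to the edges. $K^{\mathbf o}(n)$ is the biased graph of $(\vec{K_n},\gamma^{\mathbf o})$, where $\gamma^{\mathbf o}$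 assigns elements of $S$ so that two edges get the same label iff they have the same larger end. For $a\ge0$, $K^a(n)$ is the biased graph of $(\vec{K_n},\gamma^a)$ where $\gamma^a$ assigns to every edge a generator $g$ of a cyclic group that is infinite if $a=0$ and of order $a$ otherwise. Write $[v_1,\dots,v_k]$ (indices in $\mathbb Z_k$) for the circuit with edges $v_1v_2,\dots,v_{k-1}v_k,v_kv_1$. Such a circuit is oscillating if every $v_i$ satisfies $v_i<\min(v_{i-1},v_{i+1})$ or $v_i>\max(v_{i-1},v_{i+1})$. Define $\delta(C)=\big|\,|\{i\in\mathbb Z_k: v_i>v_{i-1}\}|-|\{i\in\mathbb Z_k: v_i<v_{i-1}\}|\,\big|$ (independent of the indexing). Every integer divides $0$, and $0\mid d$ iff $d=0$. -}

module Defs where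

open import Level using (Level; _⊔_)
open import Data.Nat as ℕ using (ℕ; zero; suc; _≤_; ∣_-_∣)
open import Data.Integer as ℤ using (ℤ; +_; -[1+_])
open import Data.Fin as Fin using (Fin)
open import Data.Fin.Properties using (<-cmp)
open import Data.Bool using (Bool; true; false; if_then_else_)
open import Data.Vec using (Vec; []; _∷_)
open import Data.List as List using (List; []; _∷_; _++_; [_]; length; map; foldr; zip; zipWith; reverse)
open import Data.List.Relation.Unary.All using (All)
open import Data.List.Relation.Unary.Unique.Propositional using (Unique)
open import Data.Product using (Σ; ∃; _×_; _,_; proj₁; proj₂)
open import Data.Sum using (_⊎_)
open import Relation.Binary using (tri<; tri≈; tri>)
open import Relation.Binary.PropositionalEquality using (_≡_)
open import Algebra.Bundles using (Group)

-- Edges of K_n: pairs (i , j) with i < j (oriented i → j in the acyclic orientation).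
Edge : ℕ → Set
Edge n = Σ (Fin n × Fin n) (λ p → proj₁ p Fin.< proj₂ p)

larger : ∀ {n} → Edge n → Fin n
larger ((i , j) , _) = j

-- A circuit of K_n, written [v_1,…,v_k]: k ≥ 3 pairwise distinct vertices
-- (K_n is complete, so every such sequence is a circuit).
IsCircuit : ∀ {n} → List (Fin n) → Set
IsCircuit vs = 3 ≤ length vs × Unique vs

-- rotations: rotL [v1..vk] = [v2..vk,v1], rotR [v1..vk] = [vk,v1..v(k-1)]
rotL : ∀ {A : Set} → List A → List A
rotL [] = []
rotL (x ∷ xs) = xs ++ [ x ]

rotR : ∀ {A : Set} → List A → List A
rotR xs = reverse (rotL (reverse xs))

cyclicPairs : ∀ {A : Set} → List A → List (A × A)
cyclicPairs vs = zip vs (rotL vs)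

-- the cyclic list of triples (v_{i-1} , v_i , v_{i+1}), i ∈ ℤ_k
cyclicTriples : ∀ {A : Set} → List A → List (A × A × A)
cyclicTriples vs = zipWith (λ p q → p , q) (rotR vs) (zip vs (rotL vs))

OscTriple : ∀ {n} → Fin n × Fin n × Fin n → Set
OscTriple (p , v , q) = (v Fin.< p × v Fin.< q) ⊎ (p Fin.< v × q Fin.< v)

Oscillating : ∀ {n} → List (Fin n) → Set
Oscillating vs = All OscTriple (cyclicTriples vs)

countUp : ∀ {n} → List (Fin n × Fin n) → ℕ
countUp [] = 0
countUp ((p , q) ∷ ps) with <-cmp p q
... | tri< _ _ _ = suc (countUp ps)
... | tri≈ _ _ _ = countUp ps
... | tri> _ _ _ = countUp ps

countDown : ∀ {n} → List (Fin n × Fin n) → ℕ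
countDown [] = 0
countDown ((p , q) ∷ ps) with <-cmp p q
... | tri< _ _ _ = countDown ps
... | tri≈ _ _ _ = countDown ps
... | tri> _ _ _ = suc (countDown ps)

δ : ∀ {n} → List (Fin n) → ℕ
δ vs = ∣ countUp (cyclicPairs vs) - countDown (cyclicPairs vs) ∣

module _ {c ℓ : Level} (G : Group c ℓ) where
  open Group G

  powℕ : Carrier → ℕ → Carrier
  powℕ g zero = ε
  powℕ g (suc k) = g ∙ powℕ g k

  powℤ : Carrier → ℤ → Carrier
  powℤ g (+ k) = powℕ g k
  powℤ g -[1+ k ] = (powℕ g (suc k)) ⁻¹

  IsCyclic : Set (c ⊔ ℓ)
  IsCyclic = ∃ λ g → ∀ x → ∃ λ (z : ℤ) → x ≈ powℤ g z

  Generates : Carrier → Set (c ⊔ ℓ)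
  Generates g = ∀ x → ∃ λ (z : ℤ) → x ≈ powℤ g z

  OrderAtLeast : ℕ → Set (c ⊔ ℓ)
  OrderAtLeast N = ∃ λ (f : Fin N → Carrier) → ∀ i j → f i ≈ f j → i ≡ j

  -- product of the elements of a subset A ⊆ S, S given as s : Fin m → Γ
  subsetProd : ∀ {m} → (Fin m → Carrier) → Vec Bool m → Carrier
  subsetProd s [] = ε
  subsetProd s (b ∷ A) = (if b then s Fin.zero else ε) ∙ subsetProd (λ i → s (Fin.suc i)) A

  DistinctSubsetProducts : ∀ {m} → (Fin m → Carrier) → Set ℓ
  DistinctSubsetProducts {m} s =
    (∀ i j → s i ≈ s j → i ≡ j) × (∀ (A B : Vec Bool m) → subsetProd s A ≈ subsetProd s B → A ≡ B)

  orientedLabel : ∀ {n} → (Edge n → Carrier) → Fin n × Fin n → Carrier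
  orientedLabel γ (p , q) with <-cmp p q
  ... | tri< p<q _ _ = γ ((p , q) , p<q)
  ... | tri≈ _ _ _ = ε
  ... | tri> _ _ q<p = (γ ((q , p) , q<p)) ⁻¹

  Balanced : ∀ {n} → (Edge n → Carrier) → List (Fin n) → Set ℓ
  Balanced γ vs = foldr _∙_ ε (map (orientedLabel γ) (cyclicPairs vs)) ≈ ε

-- The groups in (i)–(iii) are abelian, so the product of the oriented labels along a circuit
-- is a monomial ∏ⱼ sⱼ^cⱼ, where cⱼ counts the edges labelled j traversed upwards minus those
-- traversed downwards. Charging every traversal to the larger end of its edge writes cⱼ as a
-- sum over the vertices v of the circuit of [pred v < v with label j] − [succ v < v with label j].
-- When each label class has a single larger end, as in K^u and K^o, only one vertex contributes
-- to cⱼ, so cⱼ ∈ {−1, 0, 1}; then ∏ⱼ sⱼ^cⱼ is a quotient of two subset products of S, and it is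
-- ε only if every cⱼ, hence every vertex contribution, vanishes. In K^o a vertex contributes
-- nothing exactly when it is a local extremum; in K^u the larger of v₁, v₂ contributes ±1.
-- In K^a the product is g^(ups − downs).

module Submission where

open import Defs
open import Level using (Level)
open import Data.Nat as ℕ using (ℕ; zero; suc; _≤_; _^_)
import Data.Nat.Properties as ℕ
open import Data.Nat.Combinatorics using (_C_)
open import Data.Nat.Divisibility using (_∣_)
open import Data.Integer as ℤ using (ℤ; +_; -[1+_]; 0ℤ; 1ℤ; -1ℤ; _+_; _-_; -_; _⊖_)
import Data.Integer.Properties as ℤ
import Data.Integer.Divisibility as ℤd
open import Data.Integer.Tactic.RingSolver using (solve-∀)
open import Data.Fin as Fin using (Fin)
open import Data.Fin.Properties using (<-cmp; _≟_; _<?_; <-asym; <-irrelevant)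
open import Data.Bool using (Bool; true; false; if_then_else_)
open import Data.Vec using (Vec; tabulate; lookup)
open import Data.Vec.Properties using (lookup∘tabulate)
open import Data.List using (List; []; _∷_; _++_; [_]; length; map; foldr; zip; reverse)
open import Data.List.Properties
  using (length-map; map-id; length-++; map-∘; zip-map; reverse-++; unfold-reverse; reverse-involutive; length-reverse; ∷-injective)
open import Data.List.Membership.Propositional using (_∈_; find)
open import Data.List.Membership.Propositional.Properties using (∈-map⁺; ∈-++⁺ˡ; ∈-++⁺ʳ)
open import Data.List.Relation.Unary.Any using (here; there)
open import Data.List.Relation.Unary.All as All using (All; []; _∷_; all?)
open import Data.List.Relation.Unary.All.Properties using (¬All⇒Any¬)
open import Data.List.Relation.Unary.AllPairs using (_∷_)
open import Data.List.Relation.Unary.Unique.Propositional using (Unique)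
open import Data.Product using (∃; _×_; _,_; proj₁; proj₂; swap)
open import Data.Sum using (_⊎_; inj₁; inj₂; [_,_]′)
open import Data.Empty using (⊥; ⊥-elim)
open import Function using (_∘_; id)
open import Function.Bundles using (_⤖_; _⇔_; mk⇔; Equivalence; Bijection)
open import Function.Construct.Composition using (_⇔-∘_)
open import Relation.Nullary using (¬_; yes; no; does)
open import Relation.Nullary.Decidable using (dec-true; dec-false)
open import Relation.Binary using (Tri; tri<; tri≈; tri>)
open import Relation.Binary.PropositionalEquality as ≡ using (_≡_; _≢_)
open import Algebra.Bundles using (Group; AbelianGroup)

-- Integer sums over lists

sumℤ : ∀ {A : Set} → (A → ℤ) → List A → ℤ
sumℤ F []       = 0ℤ
sumℤ F (x ∷ xs) = F x + sumℤ F xs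

module _ {A : Set} where
  open ≡ using (refl; sym; trans; cong; cong₂; subst; module ≡-Reasoning)

  sumℤ-++ : ∀ (F : A → ℤ) xs ys → sumℤ F (xs ++ ys) ≡ sumℤ F xs + sumℤ F ys
  sumℤ-++ F []       ys = sym (ℤ.+-identityˡ _)
  sumℤ-++ F (x ∷ xs) ys = trans (cong (λ t → F x + t) (sumℤ-++ F xs ys)) (sym (ℤ.+-assoc (F x) _ _))

  sumℤ-rotL : ∀ (F : A → ℤ) xs → sumℤ F (rotL xs) ≡ sumℤ F xs
  sumℤ-rotL F []       = refl
  sumℤ-rotL F (x ∷ xs) = begin
    sumℤ F (xs ++ [ x ])       ≡⟨ sumℤ-++ F xs [ x ] ⟩
    sumℤ F xs + (F x + 0ℤ)     ≡⟨ cong (λ t → sumℤ F xs + t) (ℤ.+-identityʳ (F x)) ⟩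
    sumℤ F xs + F x            ≡⟨ ℤ.+-comm (sumℤ F xs) (F x) ⟩
    F x + sumℤ F xs            ∎
    where open ≡-Reasoning

  sumℤ-map : ∀ {B : Set} (F : B → ℤ) (g : A → B) xs → sumℤ F (map g xs) ≡ sumℤ (F ∘ g) xs
  sumℤ-map F g []       = refl
  sumℤ-map F g (x ∷ xs) = cong (λ t → F (g x) + t) (sumℤ-map F g xs)

  sumℤ-- : ∀ (F H : A → ℤ) xs → sumℤ (λ x → F x - H x) xs ≡ sumℤ F xs - sumℤ H xs
  sumℤ-- F H []       = refl
  sumℤ-- F H (x ∷ xs) = trans (cong (λ t → F x - H x + t) (sumℤ-- F H xs)) (interchange (F x) (H x) _ _)
    where
    interchange : ∀ a b c d → (a - b) + (c - d) ≡ (a + c) - (b + d)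
    interchange = solve-∀

  sumℤ-zero : ∀ {F : A → ℤ} {xs} → All (λ x → F x ≡ 0ℤ) xs → sumℤ F xs ≡ 0ℤ
  sumℤ-zero []            = refl
  sumℤ-zero (Fx≡0 ∷ rest) = cong₂ _+_ Fx≡0 (sumℤ-zero rest)

  module _ {K : Set} (F : A → ℤ) (key : A → K)
           (nonzero⇒same-key : ∀ x y → F x ≢ 0ℤ → F y ≢ 0ℤ → key x ≡ key y) where

    sumℤ-single : ∀ {xs} → Unique (map key xs) → ∀ {x} → x ∈ xs → F x ≢ 0ℤ → sumℤ F xs ≡ F x
    sumℤ-single {y ∷ ys} (y∉ys ∷ _) (here refl) Fy≢0 =
      trans (cong (λ t → F y + t) (sumℤ-zero (All.tabulate vanishes))) (ℤ.+-identityʳ (F y))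
      where
      vanishes : ∀ {z} → z ∈ ys → F z ≡ 0ℤ
      vanishes {z} z∈ys with F z ℤ.≟ 0ℤ
      ... | yes Fz≡0 = Fz≡0
      ... | no Fz≢0  = ⊥-elim (All.lookup y∉ys (∈-map⁺ key z∈ys) (nonzero⇒same-key y z Fy≢0 Fz≢0))
    sumℤ-single {y ∷ ys} (y∉ys ∷ ys-uniq) (there x∈ys) Fx≢0 with F y ℤ.≟ 0ℤ
    ... | yes Fy≡0 = trans (cong (_+ sumℤ F ys) Fy≡0) (trans (ℤ.+-identityˡ _) (sumℤ-single ys-uniq x∈ys Fx≢0))
    ... | no Fy≢0  = ⊥-elim (All.lookup y∉ys (∈-map⁺ key x∈ys) (nonzero⇒same-key y _ Fy≢0 Fx≢0))

    sumℤ-single-support : ∀ {p} {P : ℤ → Set p} → P 0ℤ → (∀ x → P (F x)) →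
      ∀ {xs} → Unique (map key xs) → P (sumℤ F xs)
    sumℤ-single-support {P = P} P0 PF {xs} keys-uniq with all? (λ x → F x ℤ.≟ 0ℤ) xs
    ... | yes all≡0 = subst P (sym (sumℤ-zero all≡0)) P0
    ... | no ¬all≡0 with find (¬All⇒Any¬ (λ x → F x ℤ.≟ 0ℤ) xs ¬all≡0)
    ...   | x , x∈xs , Fx≢0 = subst P (sym (sumℤ-single keys-uniq x∈xs Fx≢0)) (PF x)

-- Cyclic pairs and triples

module _ {A B : Set} where
  open ≡ using (refl; cong)

  map-proj₁-zip : ∀ (xs : List A) (ys : List B) → length xs ≡ length ys → map proj₁ (zip xs ys) ≡ xs
  map-proj₁-zip []       []       _  = refl
  map-proj₁-zip (x ∷ xs) (y ∷ ys) eq = cong (x ∷_) (map-proj₁-zip xs ys (ℕ.suc-injective eq))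

  map-proj₂-zip : ∀ (xs : List A) (ys : List B) → length xs ≡ length ys → map proj₂ (zip xs ys) ≡ ys
  map-proj₂-zip []       []       _  = refl
  map-proj₂-zip (x ∷ xs) (y ∷ ys) eq = cong (y ∷_) (map-proj₂-zip xs ys (ℕ.suc-injective eq))

  zip-++-[] : ∀ (xs : List A) (ys : List B) x y → length xs ≡ length ys →
    zip (xs ++ [ x ]) (ys ++ [ y ]) ≡ zip xs ys ++ [ (x , y) ]
  zip-++-[] []       []       x y _  = refl
  zip-++-[] (a ∷ xs) (b ∷ ys) x y eq = cong ((a , b) ∷_) (zip-++-[] xs ys x y (ℕ.suc-injective eq))

module _ {A : Set} where
  open ≡ using (refl; sym; trans; cong; module ≡-Reasoning)

  length-rotL : ∀ (xs : List A) → length (rotL xs) ≡ length xs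
  length-rotL []       = refl
  length-rotL (x ∷ xs) = trans (length-++ xs) (ℕ.+-comm (length xs) 1)

  length-rotR : ∀ (xs : List A) → length (rotR xs) ≡ length xs
  length-rotR xs = begin
    length (reverse (rotL (reverse xs))) ≡⟨ length-reverse (rotL (reverse xs)) ⟩
    length (rotL (reverse xs))           ≡⟨ length-rotL (reverse xs) ⟩
    length (reverse xs)                  ≡⟨ length-reverse xs ⟩
    length xs                            ∎
    where open ≡-Reasoning

  rotL-rotR : ∀ (xs : List A) → rotL (rotR xs) ≡ xs
  rotL-rotR xs = trans (rotL-reverse-rotL (reverse xs)) (reverse-involutive xs)
    where
    rotL-reverse-rotL : ∀ ys → rotL (reverse (rotL ys)) ≡ reverse ys
    rotL-reverse-rotL []       = refl
    rotL-reverse-rotL (y ∷ ys) = trans (cong rotL (reverse-++ ys [ y ])) (sym (unfold-reverse y ys))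

  ∈-rotL⁺ : ∀ {x} {xs : List A} → x ∈ xs → x ∈ rotL xs
  ∈-rotL⁺ {xs = y ∷ ys} (here x≡y) = ∈-++⁺ʳ ys (here x≡y)
  ∈-rotL⁺ {xs = y ∷ ys} (there x∈ys) = ∈-++⁺ˡ x∈ys

module _ {A : Set} where
  open ≡ using (refl; sym; trans; cong; cong₂; subst; module ≡-Reasoning)

  cyclicPairs-rotL : ∀ (xs : List A) → cyclicPairs (rotL xs) ≡ rotL (cyclicPairs xs)
  cyclicPairs-rotL []           = refl
  cyclicPairs-rotL (x ∷ [])     = refl
  cyclicPairs-rotL (x ∷ y ∷ ys) = zip-++-[] (y ∷ ys) (ys ++ [ x ]) x y (sym (length-rotL (x ∷ ys)))

  map-proj₁-cyclicPairs : ∀ (xs : List A) → map proj₁ (cyclicPairs xs) ≡ xs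
  map-proj₁-cyclicPairs xs = map-proj₁-zip xs (rotL xs) (sym (length-rotL xs))

  length-cyclicPairs : ∀ (xs : List A) → length (cyclicPairs xs) ≡ length xs
  length-cyclicPairs xs = trans (sym (length-map proj₁ (cyclicPairs xs))) (cong length (map-proj₁-cyclicPairs xs))

  front : A × A × A → A × A
  front (p , v , q) = p , v

  map-front-cyclicTriples : ∀ (xs : List A) → map front (cyclicTriples xs) ≡ cyclicPairs (rotR xs)
  map-front-cyclicTriples xs = begin
    map front (zip (rotR xs) (cyclicPairs xs))                ≡⟨ zip-map id proj₁ (rotR xs) (cyclicPairs xs) ⟨
    zip (map id (rotR xs)) (map proj₁ (cyclicPairs xs))       ≡⟨ cong₂ zip (map-id (rotR xs)) (map-proj₁-cyclicPairs xs) ⟩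
    zip (rotR xs) xs                                          ≡⟨ cong (zip (rotR xs)) (rotL-rotR xs) ⟨
    cyclicPairs (rotR xs)                                     ∎
    where open ≡-Reasoning

  map-proj₂-cyclicTriples : ∀ (xs : List A) → map proj₂ (cyclicTriples xs) ≡ cyclicPairs xs
  map-proj₂-cyclicTriples xs =
    map-proj₂-zip (rotR xs) (cyclicPairs xs) (trans (length-rotR xs) (sym (length-cyclicPairs xs)))

  map-mid-cyclicTriples : ∀ (xs : List A) → map (proj₁ ∘ proj₂) (cyclicTriples xs) ≡ xs
  map-mid-cyclicTriples xs = begin
    map (proj₁ ∘ proj₂) (cyclicTriples xs)       ≡⟨ map-∘ (cyclicTriples xs) ⟩
    map proj₁ (map proj₂ (cyclicTriples xs))     ≡⟨ cong (map proj₁) (map-proj₂-cyclicTriples xs) ⟩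
    map proj₁ (cyclicPairs xs)                   ≡⟨ map-proj₁-cyclicPairs xs ⟩
    xs                                           ∎
    where open ≡-Reasoning

  cyclicPairs≡rotL-cyclicPairs-rotR : ∀ (xs : List A) → cyclicPairs xs ≡ rotL (cyclicPairs (rotR xs))
  cyclicPairs≡rotL-cyclicPairs-rotR xs = trans (cong cyclicPairs (sym (rotL-rotR xs))) (cyclicPairs-rotL (rotR xs))

  ∈-cyclicTriples⇒front : ∀ {p v q} (xs : List A) → (p , v , q) ∈ cyclicTriples xs → (p , v) ∈ cyclicPairs xs
  ∈-cyclicTriples⇒front xs t∈ = subst ((_ , _) ∈_) (sym (cyclicPairs≡rotL-cyclicPairs-rotR xs))
    (∈-rotL⁺ (subst ((_ , _) ∈_) (map-front-cyclicTriples xs) (∈-map⁺ front t∈)))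

  ∈-cyclicTriples⇒back : ∀ {p v q} (xs : List A) → (p , v , q) ∈ cyclicTriples xs → (v , q) ∈ cyclicPairs xs
  ∈-cyclicTriples⇒back xs t∈ = subst ((_ , _) ∈_) (map-proj₂-cyclicTriples xs) (∈-map⁺ proj₂ t∈)

  sumℤ-cyclicPairs≡sumℤ-cyclicTriples : ∀ (F : A × A → ℤ) xs →
    sumℤ (λ e → F e - F (swap e)) (cyclicPairs xs) ≡ sumℤ (λ t → F (front t) - F (swap (proj₂ t))) (cyclicTriples xs)
  sumℤ-cyclicPairs≡sumℤ-cyclicTriples F xs = begin
    sumℤ (λ e → F e - F (swap e)) (cyclicPairs xs)                          ≡⟨ sumℤ-- F (F ∘ swap) (cyclicPairs xs) ⟩
    sumℤ F (cyclicPairs xs) - sumℤ (F ∘ swap) (cyclicPairs xs)              ≡⟨ cong (λ P → sumℤ F P - down) (cyclicPairs≡rotL-cyclicPairs-rotR xs) ⟩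
    sumℤ F (rotL (cyclicPairs (rotR xs))) - sumℤ (F ∘ swap) (cyclicPairs xs) ≡⟨ cong (_- down) (sumℤ-rotL F (cyclicPairs (rotR xs))) ⟩
    sumℤ F (cyclicPairs (rotR xs)) - sumℤ (F ∘ swap) (cyclicPairs xs)        ≡⟨ cong₂ _-_ (cong (sumℤ F) (sym (map-front-cyclicTriples xs)))
                                                                                          (cong (sumℤ (F ∘ swap)) (sym (map-proj₂-cyclicTriples xs))) ⟩
    sumℤ F (map front T) - sumℤ (F ∘ swap) (map proj₂ T)                   ≡⟨ cong₂ _-_ (sumℤ-map F front T) (sumℤ-map (F ∘ swap) proj₂ T) ⟩
    sumℤ (F ∘ front) T - sumℤ (F ∘ swap ∘ proj₂) T                          ≡⟨ sumℤ-- (F ∘ front) (F ∘ swap ∘ proj₂) T ⟨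
    sumℤ (λ t → F (front t) - F (swap (proj₂ t))) T                         ∎
    where
    open ≡-Reasoning
    T : List (A × A × A)
    T = cyclicTriples xs
    down : ℤ
    down = sumℤ (F ∘ swap) (cyclicPairs xs)

  cyclicPairs-distinct : ∀ {xs : List A} → 2 ℕ.≤ length xs → Unique xs → ∀ {a b} → (a , b) ∈ cyclicPairs xs → a ≢ b
  cyclicPairs-distinct {_ ∷ []}     (ℕ.s≤s ())                 _
  cyclicPairs-distinct {x ∷ y ∷ ys} _ ((x≢y ∷ _) ∷ _)           (here refl) = x≢y
  cyclicPairs-distinct {x ∷ y ∷ ys} _ ((x≢y ∷ x≢ys) ∷ y∷ys-uniq) (there ab∈) =
    open-path-distinct y∷ys-uniq (All.map (_∘ sym) (x≢y ∷ x≢ys)) ab∈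
    where
    open-path-distinct : ∀ {u us a b} → Unique (u ∷ us) → All (_≢ x) (u ∷ us) →
      (a , b) ∈ zip (u ∷ us) (us ++ [ x ]) → a ≢ b
    open-path-distinct {us = []}     _                     (u≢x ∷ _) (here refl) = u≢x
    open-path-distinct {us = w ∷ ws} ((u≢w ∷ _) ∷ _)       _         (here refl) = u≢w
    open-path-distinct {us = w ∷ ws} (_ ∷ w∷ws-uniq) (_ ∷ w∷ws≢x)   (there ab∈) = open-path-distinct w∷ws-uniq w∷ws≢x ab∈

  firstTwoTriples : ∀ (v₁ v₂ v₃ : A) vs → ∃ λ w → w ∈ v₃ ∷ vs ×
    (w , v₁ , v₂) ∈ cyclicTriples (v₁ ∷ v₂ ∷ v₃ ∷ vs) × (v₁ , v₂ , v₃) ∈ cyclicTriples (v₁ ∷ v₂ ∷ v₃ ∷ vs)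
  firstTwoTriples v₁ v₂ v₃ vs = triplesFrom (rotR (v₁ ∷ v₂ ∷ v₃ ∷ vs)) (rotL-rotR (v₁ ∷ v₂ ∷ v₃ ∷ vs))
    where
    triplesFrom : ∀ r → rotL r ≡ v₁ ∷ v₂ ∷ v₃ ∷ vs → ∃ λ w → w ∈ v₃ ∷ vs ×
      (w , v₁ , v₂) ∈ zip r (cyclicPairs (v₁ ∷ v₂ ∷ v₃ ∷ vs)) × (v₁ , v₂ , v₃) ∈ zip r (cyclicPairs (v₁ ∷ v₂ ∷ v₃ ∷ vs))
    triplesFrom (w ∷ u₁ ∷ u₂ ∷ us) eq with ∷-injective eq
    ... | refl , eq′ with ∷-injective eq′
    ... | refl , us++w≡v₃∷vs = w , subst (w ∈_) us++w≡v₃∷vs (∈-++⁺ʳ us (here refl)) , here refl , there (here refl)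

-- Abelian groups and integer powers

module _ {c ℓ : Level} (G : Group c ℓ) where
  open Group G
  open import Relation.Binary.Reasoning.Setoid setoid

  Commute : Carrier → Carrier → Set ℓ
  Commute x y = x ∙ y ≈ y ∙ x

  commute-ε : ∀ x → Commute x ε
  commute-ε x = trans (identityʳ x) (sym (identityˡ x))

  commute-∙ : ∀ {x y z} → Commute x y → Commute x z → Commute x (y ∙ z)
  commute-∙ {x} {y} {z} xy xz = begin
    x ∙ (y ∙ z) ≈⟨ assoc x y z ⟨
    (x ∙ y) ∙ z ≈⟨ ∙-congʳ xy ⟩
    (y ∙ x) ∙ z ≈⟨ assoc y x z ⟩
    y ∙ (x ∙ z) ≈⟨ ∙-congˡ xz ⟩
    y ∙ (z ∙ x) ≈⟨ assoc y z x ⟨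
    (y ∙ z) ∙ x ∎

  commute-⁻¹ : ∀ {x y} → Commute x y → Commute x (y ⁻¹)
  commute-⁻¹ {x} {y} xy = begin
    x ∙ y ⁻¹               ≈⟨ identityˡ _ ⟨
    ε ∙ (x ∙ y ⁻¹)         ≈⟨ ∙-congʳ (inverseˡ y) ⟨
    (y ⁻¹ ∙ y) ∙ (x ∙ y ⁻¹) ≈⟨ assoc _ _ _ ⟩
    y ⁻¹ ∙ (y ∙ (x ∙ y ⁻¹)) ≈⟨ ∙-congˡ (assoc _ _ _) ⟨
    y ⁻¹ ∙ ((y ∙ x) ∙ y ⁻¹) ≈⟨ ∙-congˡ (∙-congʳ xy) ⟨
    y ⁻¹ ∙ ((x ∙ y) ∙ y ⁻¹) ≈⟨ ∙-congˡ (assoc _ _ _) ⟩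
    y ⁻¹ ∙ (x ∙ (y ∙ y ⁻¹)) ≈⟨ ∙-congˡ (∙-congˡ (inverseʳ y)) ⟩
    y ⁻¹ ∙ (x ∙ ε)         ≈⟨ ∙-congˡ (identityʳ x) ⟩
    y ⁻¹ ∙ x               ∎

  commute-powℤ : ∀ {x y} → Commute x y → ∀ z → Commute x (powℤ G y z)
  commute-powℤ {x} {y} xy (+ k) = commute-powℕ k
    where
    commute-powℕ : ∀ k → Commute x (powℕ G y k)
    commute-powℕ zero    = commute-ε _
    commute-powℕ (suc k) = commute-∙ xy (commute-powℕ k)
  commute-powℤ xy -[1+ k ]     = commute-⁻¹ (commute-powℤ xy (+ suc k))

  powℤ-commute : ∀ g a b → Commute (powℤ G g a) (powℤ G g b)
  powℤ-commute g a b = commute-powℤ (sym (commute-powℤ refl a)) b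

  generator⇒commutative : ∀ {g} → Generates G g → ∀ x y → Commute x y
  generator⇒commutative {g} gen x y with gen x | gen y
  ... | a , x≈gᵃ | b , y≈gᵇ = begin
    x ∙ y                   ≈⟨ ∙-cong x≈gᵃ y≈gᵇ ⟩
    powℤ G g a ∙ powℤ G g b ≈⟨ powℤ-commute g a b ⟩
    powℤ G g b ∙ powℤ G g a ≈⟨ ∙-cong y≈gᵇ x≈gᵃ ⟨
    y ∙ x                   ∎

  abelianGroup : (∀ x y → Commute x y) → AbelianGroup c ℓ
  abelianGroup comm = record { isAbelianGroup = record { isGroup = isGroup ; comm = comm } }

  cyclicAbelian : IsCyclic G → AbelianGroup c ℓ
  cyclicAbelian (_ , generates) = abelianGroup (generator⇒commutative generates)

∣m⊖n∣≡∣m-n∣ : ∀ m n → ℤ.∣ m ⊖ n ∣ ≡ ℕ.∣ m - n ∣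
∣m⊖n∣≡∣m-n∣ zero    zero    = ≡.refl
∣m⊖n∣≡∣m-n∣ zero    (suc n) = ≡.refl
∣m⊖n∣≡∣m-n∣ (suc m) zero    = ≡.refl
∣m⊖n∣≡∣m-n∣ (suc m) (suc n) = ≡.trans (≡.cong ℤ.∣_∣ (ℤ.[1+m]⊖[1+n]≡m⊖n m n)) (∣m⊖n∣≡∣m-n∣ m n)

module _ {c ℓ : Level} (A : AbelianGroup c ℓ) where
  open AbelianGroup A
  open import Algebra.Properties.AbelianGroup A using (ε⁻¹≈ε; ⁻¹-∙-comm; \\-leftDividesˡ; \\-leftDividesʳ)
  open import Relation.Binary.Reasoning.Setoid setoid

  x∙[x∙y]⁻¹≈y⁻¹ : ∀ x y → x ∙ (x ∙ y) ⁻¹ ≈ y ⁻¹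
  x∙[x∙y]⁻¹≈y⁻¹ x y = trans (∙-congˡ (sym (⁻¹-∙-comm x y))) (\\-leftDividesˡ x (y ⁻¹))

  powℤ-suc : ∀ y z → powℤ group y (ℤ.suc z) ≈ y ∙ powℤ group y z
  powℤ-suc y (+ n)        = refl
  powℤ-suc y -[1+ zero ]  = trans (sym ε⁻¹≈ε) (sym (x∙[x∙y]⁻¹≈y⁻¹ y ε))
  powℤ-suc y -[1+ suc n ] = sym (x∙[x∙y]⁻¹≈y⁻¹ y _)

  powℤ-pred : ∀ y z → powℤ group y (ℤ.pred z) ≈ y ⁻¹ ∙ powℤ group y z
  powℤ-pred y (+ zero)   = trans (⁻¹-cong (identityʳ y)) (sym (identityʳ _))
  powℤ-pred y (+ suc n)  = sym (\\-leftDividesʳ y _)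
  powℤ-pred y -[1+ n ]   = sym (⁻¹-∙-comm y _)

  constantLabelProduct≈powℤ : ∀ {n} g (ps : List (Fin n × Fin n)) →
    foldr _∙_ ε (map (orientedLabel group (λ _ → g)) ps) ≈ powℤ group g (countUp ps ⊖ countDown ps)
  constantLabelProduct≈powℤ g [] = refl
  constantLabelProduct≈powℤ g ((p , q) ∷ ps) with <-cmp p q
  ... | tri< _ _ _ = begin
    g ∙ foldr _∙_ ε (map (orientedLabel group (λ _ → g)) ps) ≈⟨ ∙-congˡ (constantLabelProduct≈powℤ g ps) ⟩
    g ∙ powℤ group g (countUp ps ⊖ countDown ps)              ≈⟨ powℤ-suc g (countUp ps ⊖ countDown ps) ⟨
    powℤ group g (ℤ.suc (countUp ps ⊖ countDown ps))         ≡⟨ ≡.cong (powℤ group g) (ℤ.distribʳ-⊖-+-pos 1 (countUp ps) (countDown ps)) ⟩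
    powℤ group g (suc (countUp ps) ⊖ countDown ps)           ∎
  ... | tri≈ _ _ _ = trans (identityˡ _) (constantLabelProduct≈powℤ g ps)
  ... | tri> _ _ _ = begin
    g ⁻¹ ∙ foldr _∙_ ε (map (orientedLabel group (λ _ → g)) ps) ≈⟨ ∙-congˡ (constantLabelProduct≈powℤ g ps) ⟩
    g ⁻¹ ∙ powℤ group g (countUp ps ⊖ countDown ps)              ≈⟨ powℤ-pred g (countUp ps ⊖ countDown ps) ⟨
    powℤ group g (ℤ.pred (countUp ps ⊖ countDown ps))            ≡⟨ ≡.cong (powℤ group g) (ℤ.distribʳ-⊖-+-neg 0 (countUp ps) (countDown ps)) ⟩
    powℤ group g (countUp ps ⊖ suc (countDown ps))               ∎

  balanced⇔order∣δ : ∀ a g → (∀ z → powℤ group g z ≈ ε ⇔ (+ a) ℤd.∣ z) →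
    ∀ {n} (vs : List (Fin n)) → Balanced group (λ _ → g) vs ⇔ a ∣ δ vs
  balanced⇔order∣δ a g order vs = mk⇔
    (λ bal → ≡.subst (a ∣_) ∣z∣≡δ (Equivalence.to (order z) (trans (sym product≈gᶻ) bal)))
    (λ a∣δ → trans product≈gᶻ (Equivalence.from (order z) (≡.subst (a ∣_) (≡.sym ∣z∣≡δ) a∣δ)))
    where
    z : ℤ
    z = countUp (cyclicPairs vs) ⊖ countDown (cyclicPairs vs)
    product≈gᶻ : foldr _∙_ ε (map (orientedLabel group (λ _ → g)) (cyclicPairs vs)) ≈ powℤ group g z
    product≈gᶻ = constantLabelProduct≈powℤ g (cyclicPairs vs)
    ∣z∣≡δ : ℤ.∣ z ∣ ≡ δ vs
    ∣z∣≡δ = ∣m⊖n∣≡∣m-n∣ (countUp (cyclicPairs vs)) (countDown (cyclicPairs vs))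

-- Monomials in the labels

unit : ∀ {m} → Fin m → ℤ → Fin m → ℤ
unit k d j = if does (k ≟ j) then d else 0ℤ

unit-diag : ∀ {m} (k : Fin m) d → unit k d k ≡ d
unit-diag k d rewrite dec-true (k ≟ k) ≡.refl = ≡.refl

unit-off : ∀ {m} {k j : Fin m} d → k ≢ j → unit k d j ≡ 0ℤ
unit-off {k = k} {j} d k≢j rewrite dec-false (k ≟ j) k≢j = ≡.refl

-‿unit : ∀ {m} (k j : Fin m) d → - unit k d j ≡ unit k (- d) j
-‿unit k j d with does (k ≟ j)
... | true  = ≡.refl
... | false = ≡.refl

Trit : ℤ → Set
Trit z = z ≡ 0ℤ ⊎ z ≡ 1ℤ ⊎ z ≡ -1ℤ

positive? negative? : ℤ → Bool
positive? z = does (0ℤ ℤ.<? z)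
negative? z = does (z ℤ.<? 0ℤ)

positives negatives : ∀ {m} → (Fin m → ℤ) → Vec Bool m
positives e = tabulate (positive? ∘ e)
negatives e = tabulate (negative? ∘ e)

trit-sign : ∀ {z} → Trit z → positive? z ≡ negative? z → z ≡ 0ℤ
trit-sign (inj₁ z≡0)              _  = z≡0
trit-sign (inj₂ (inj₁ ≡.refl)) ()
trit-sign (inj₂ (inj₂ ≡.refl)) ()

module Monomials {c ℓ : Level} (A : AbelianGroup c ℓ) where
  open AbelianGroup A
  open import Algebra.Properties.AbelianGroup A using (ε⁻¹≈ε; ⁻¹-∙-comm; x∙y⁻¹≈ε⇒x≈y)
  open import Algebra.Properties.CommutativeSemigroup commutativeSemigroup using (x∙yz≈y∙xz; interchange)
  open import Relation.Binary.Reasoning.Setoid setoid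

  monomial : ∀ {m} → (Fin m → Carrier) → (Fin m → ℤ) → Carrier
  monomial {zero}  s e = ε
  monomial {suc m} s e = powℤ group (s Fin.zero) (e Fin.zero) ∙ monomial (s ∘ Fin.suc) (e ∘ Fin.suc)

  monomial-cong : ∀ {m} (s : Fin m → Carrier) {e e′ : Fin m → ℤ} → (∀ j → e j ≡ e′ j) → monomial s e ≈ monomial s e′
  monomial-cong {zero}  s e≗e′ = refl
  monomial-cong {suc m} s e≗e′ =
    ∙-cong (reflexive (≡.cong (powℤ group (s Fin.zero)) (e≗e′ Fin.zero))) (monomial-cong (s ∘ Fin.suc) (e≗e′ ∘ Fin.suc))

  monomial-zero : ∀ {m} (s : Fin m → Carrier) {e : Fin m → ℤ} → (∀ j → e j ≡ 0ℤ) → monomial s e ≈ ε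
  monomial-zero {zero}  s e≗0 = refl
  monomial-zero {suc m} s e≗0 = trans (∙-cong (reflexive (≡.cong (powℤ group (s Fin.zero)) (e≗0 Fin.zero)))
                                              (monomial-zero (s ∘ Fin.suc) (e≗0 ∘ Fin.suc)))
                                      (identityˡ ε)

  monomial-unit : ∀ {m} (s : Fin m → Carrier) (e : Fin m → ℤ) (k : Fin m) d (h : Carrier → Carrier) →
    (∀ y z → powℤ group y (d + z) ≈ h y ∙ powℤ group y z) →
    monomial s (λ j → unit k d j + e j) ≈ h (s k) ∙ monomial s e
  monomial-unit {suc m} s e Fin.zero d h pow-d = begin
    powℤ group (s Fin.zero) (d + e Fin.zero) ∙ monomial (s ∘ Fin.suc) (λ j → 0ℤ + e (Fin.suc j))
      ≈⟨ ∙-cong (pow-d _ _) (monomial-cong (s ∘ Fin.suc) (λ j → ℤ.+-identityˡ (e (Fin.suc j)))) ⟩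
    (h (s Fin.zero) ∙ powℤ group (s Fin.zero) (e Fin.zero)) ∙ monomial (s ∘ Fin.suc) (e ∘ Fin.suc)
      ≈⟨ assoc _ _ _ ⟩
    h (s Fin.zero) ∙ monomial s e ∎
  monomial-unit {suc m} s e (Fin.suc k) d h pow-d = begin
    powℤ group (s Fin.zero) (0ℤ + e Fin.zero) ∙ monomial (s ∘ Fin.suc) (λ j → unit k d j + e (Fin.suc j))
      ≈⟨ ∙-cong (reflexive (≡.cong (powℤ group (s Fin.zero)) (ℤ.+-identityˡ (e Fin.zero))))
                (monomial-unit (s ∘ Fin.suc) (e ∘ Fin.suc) k d h pow-d) ⟩
    powℤ group (s Fin.zero) (e Fin.zero) ∙ (h (s (Fin.suc k)) ∙ monomial (s ∘ Fin.suc) (e ∘ Fin.suc))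
      ≈⟨ x∙yz≈y∙xz _ _ _ ⟩
    h (s (Fin.suc k)) ∙ monomial s e ∎

  powℤ-trit : ∀ x {z} → Trit z → powℤ group x z ≈ (if positive? z then x else ε) ∙ (if negative? z then x else ε) ⁻¹
  powℤ-trit x (inj₁ ≡.refl)        = sym (inverseʳ ε)
  powℤ-trit x (inj₂ (inj₁ ≡.refl)) = ∙-congˡ (sym ε⁻¹≈ε)
  powℤ-trit x (inj₂ (inj₂ ≡.refl)) = trans (⁻¹-cong (identityʳ x)) (sym (identityˡ _))

  monomial-trit : ∀ {m} (s : Fin m → Carrier) (e : Fin m → ℤ) → (∀ j → Trit (e j)) →
    monomial s e ≈ subsetProd group s (positives e) ∙ subsetProd group s (negatives e) ⁻¹
  monomial-trit {zero}  s e _    = sym (inverseʳ ε)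
  monomial-trit {suc m} s e trit = begin
    powℤ group s₀ (e Fin.zero) ∙ monomial (s ∘ Fin.suc) (e ∘ Fin.suc)
      ≈⟨ ∙-cong (powℤ-trit s₀ (trit Fin.zero)) (monomial-trit (s ∘ Fin.suc) (e ∘ Fin.suc) (trit ∘ Fin.suc)) ⟩
    (a ∙ b ⁻¹) ∙ (P ∙ N ⁻¹) ≈⟨ interchange a (b ⁻¹) P (N ⁻¹) ⟩
    (a ∙ P) ∙ (b ⁻¹ ∙ N ⁻¹) ≈⟨ ∙-congˡ (⁻¹-∙-comm b N) ⟩
    (a ∙ P) ∙ (b ∙ N) ⁻¹    ∎
    where
    s₀ a b P N : Carrier
    s₀ = s Fin.zero
    a = if positive? (e Fin.zero) then s₀ else ε
    b = if negative? (e Fin.zero) then s₀ else ε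
    P = subsetProd group (s ∘ Fin.suc) (positives (e ∘ Fin.suc))
    N = subsetProd group (s ∘ Fin.suc) (negatives (e ∘ Fin.suc))

  monomial≈ε⇒≡0 : ∀ {m} {s : Fin m → Carrier} {e : Fin m → ℤ} → DistinctSubsetProducts group s →
    (∀ j → Trit (e j)) → monomial s e ≈ ε → ∀ j → e j ≡ 0ℤ
  monomial≈ε⇒≡0 {s = s} {e} (_ , subsetProd-injective) trit s^e≈ε j = trit-sign (trit j) (
    ≡.trans (≡.sym (lookup∘tabulate (positive? ∘ e) j))
      (≡.trans (≡.cong (λ v → lookup v j) positives≡negatives) (lookup∘tabulate (negative? ∘ e) j)))
    where
    positives≡negatives : positives e ≡ negatives e
    positives≡negatives = subsetProd-injective _ _ (x∙y⁻¹≈ε⇒x≈y _ _ (trans (sym (monomial-trit s e trit)) s^e≈ε))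

-- Exponents of the labels along a circuit

≡1⇒≢0 : ∀ {z} → z ≡ 1ℤ → z ≢ 0ℤ
≡1⇒≢0 ≡.refl ()

≡-1⇒≢0 : ∀ {z} → z ≡ -1ℤ → z ≢ 0ℤ
≡-1⇒≢0 ≡.refl ()

module _ {n m : ℕ} (f : Edge n → Fin m) where

  ascent : Fin m → Fin n × Fin n → ℤ
  ascent j (p , q) with p <? q
  ... | yes p<q = unit (f ((p , q) , p<q)) 1ℤ j
  ... | no _    = 0ℤ

  -- stepExponent j e is the exponent of s j in the oriented label of the step e;
  -- vertexExponent charges each step to the larger end of its edge.
  stepExponent : Fin m → Fin n × Fin n → ℤ
  stepExponent j e = ascent j e - ascent j (swap e)

  vertexExponent : Fin m → Fin n × Fin n × Fin n → ℤ
  vertexExponent j t = ascent j (front t) - ascent j (swap (proj₂ t))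

  ascent-< : ∀ {j p q} (p<q : p Fin.< q) → ascent j (p , q) ≡ unit (f ((p , q) , p<q)) 1ℤ j
  ascent-< {j} {p} {q} p<q with p <? q
  ... | yes p<q′ = ≡.cong (λ lt → unit (f ((p , q) , lt)) 1ℤ j) (<-irrelevant p<q′ p<q)
  ... | no p≮q   = ⊥-elim (p≮q p<q)

  ascent-≮ : ∀ {j p q} → ¬ p Fin.< q → ascent j (p , q) ≡ 0ℤ
  ascent-≮ {p = p} {q} p≮q with p <? q
  ... | yes p<q = ⊥-elim (p≮q p<q)
  ... | no _    = ≡.refl

  ascent-unlabelled : ∀ {j p q} → (∀ (p<q : p Fin.< q) → f ((p , q) , p<q) ≢ j) → ascent j (p , q) ≡ 0ℤ
  ascent-unlabelled {j} {p} {q} unlabelled with p <? q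
  ... | yes p<q = unit-off 1ℤ (unlabelled p<q)
  ... | no _    = ≡.refl

  ascent-view : ∀ j p q → ascent j (p , q) ≡ 0ℤ ⊎ (ascent j (p , q) ≡ 1ℤ × ∃ λ e → f e ≡ j × larger e ≡ q)
  ascent-view j p q with p <? q
  ... | no _ = inj₁ ≡.refl
  ... | yes p<q with f ((p , q) , p<q) ≟ j
  ...   | yes fe≡j = inj₂ (≡.refl , ((p , q) , p<q) , fe≡j , ≡.refl)
  ...   | no _     = inj₁ ≡.refl

  stepExponent-< : ∀ {j p q} (p<q : p Fin.< q) → stepExponent j (p , q) ≡ unit (f ((p , q) , p<q)) 1ℤ j
  stepExponent-< {j} p<q = ≡.trans (≡.cong₂ _-_ (ascent-< p<q) (ascent-≮ (<-asym p<q))) (ℤ.+-identityʳ _)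

  stepExponent-> : ∀ {j p q} (q<p : q Fin.< p) → stepExponent j (p , q) ≡ unit (f ((q , p) , q<p)) -1ℤ j
  stepExponent-> {j} {p} {q} q<p = ≡.trans (≡.cong₂ _-_ (ascent-≮ (<-asym q<p)) (ascent-< q<p))
                                           (≡.trans (ℤ.+-identityˡ _) (-‿unit (f ((q , p) , q<p)) j 1ℤ))

  stepExponent-diag : ∀ j p → stepExponent j (p , p) ≡ 0ℤ
  stepExponent-diag j p = ℤ.+-inverseʳ (ascent j (p , p))

  vertexExponent-trit : ∀ j t → Trit (vertexExponent j t)
  vertexExponent-trit j (p , v , q) with ascent-view j p v | ascent-view j q v
  ... | inj₁ a≡0       | inj₁ b≡0       = inj₁ (≡.cong₂ _-_ a≡0 b≡0)
  ... | inj₂ (a≡1 , _) | inj₁ b≡0       = inj₂ (inj₁ (≡.cong₂ _-_ a≡1 b≡0))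
  ... | inj₁ a≡0       | inj₂ (b≡1 , _) = inj₂ (inj₂ (≡.cong₂ _-_ a≡0 b≡1))
  ... | inj₂ (a≡1 , _) | inj₂ (b≡1 , _) = inj₁ (≡.cong₂ _-_ a≡1 b≡1)

  vertexExponent-labelled : ∀ {j p v q} → vertexExponent j (p , v , q) ≢ 0ℤ → ∃ λ e → f e ≡ j × larger e ≡ v
  vertexExponent-labelled {j} {p} {v} {q} ≢0 with ascent-view j p v | ascent-view j q v
  ... | inj₂ (_ , labelled) | _                   = labelled
  ... | inj₁ _              | inj₂ (_ , labelled) = labelled
  ... | inj₁ a≡0            | inj₁ b≡0            = ⊥-elim (≢0 (≡.cong₂ _-_ a≡0 b≡0))

  vertexExponent-up : ∀ {p v q} (p<v : p Fin.< v) → (∀ (q<v : q Fin.< v) → f ((q , v) , q<v) ≢ f ((p , v) , p<v)) →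
    vertexExponent (f ((p , v) , p<v)) (p , v , q) ≡ 1ℤ
  vertexExponent-up {p} {v} p<v unlabelled =
    ≡.cong₂ _-_ (≡.trans (ascent-< p<v) (unit-diag (f ((p , v) , p<v)) 1ℤ)) (ascent-unlabelled unlabelled)

  vertexExponent-down : ∀ {p v q} (q<v : q Fin.< v) → (∀ (p<v : p Fin.< v) → f ((p , v) , p<v) ≢ f ((q , v) , q<v)) →
    vertexExponent (f ((q , v) , q<v)) (p , v , q) ≡ -1ℤ
  vertexExponent-down {v = v} {q} q<v unlabelled =
    ≡.cong₂ _-_ (ascent-unlabelled unlabelled) (≡.trans (ascent-< q<v) (unit-diag (f ((q , v) , q<v)) 1ℤ))

  vertexExponent-oscillating : ∀ {j p v q} → (∀ e e′ → larger e ≡ larger e′ → f e ≡ f e′) →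
    OscTriple (p , v , q) → vertexExponent j (p , v , q) ≡ 0ℤ
  vertexExponent-oscillating _ (inj₁ (v<p , v<q)) = ≡.cong₂ _-_ (ascent-≮ (<-asym v<p)) (ascent-≮ (<-asym v<q))
  vertexExponent-oscillating {j} {p} {v} {q} same (inj₂ (p<v , q<v)) = ≡.trans
    (≡.cong₂ _-_ (≡.trans (ascent-< p<v) (≡.cong (λ k → unit k 1ℤ j) (same ((p , v) , p<v) ((q , v) , q<v) ≡.refl)))
                 (ascent-< q<v))
    (ℤ.+-inverseʳ (unit (f ((q , v) , q<v)) 1ℤ j))

  oscillating⊎vertexExponent≢0 : ∀ {p v q} → p ≢ v → v ≢ q →
    OscTriple (p , v , q) ⊎ ∃ λ j → vertexExponent j (p , v , q) ≢ 0ℤ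
  oscillating⊎vertexExponent≢0 {p} {v} {q} p≢v v≢q with <-cmp p v | <-cmp v q
  ... | tri≈ _ p≡v _ | _              = ⊥-elim (p≢v p≡v)
  ... | _            | tri≈ _ v≡q _   = ⊥-elim (v≢q v≡q)
  ... | tri< p<v _ _ | tri> _ _ q<v   = inj₁ (inj₂ (p<v , q<v))
  ... | tri> _ _ v<p | tri< v<q _ _   = inj₁ (inj₁ (v<p , v<q))
  ... | tri< p<v _ _ | tri< v<q _ _   = inj₂ (_ , ≡1⇒≢0 (vertexExponent-up p<v (λ q<v _ → <-asym v<q q<v)))
  ... | tri> _ _ v<p | tri> _ _ q<v   = inj₂ (_ , ≡-1⇒≢0 (vertexExponent-down q<v (λ p<v _ → <-asym v<p p<v)))

  SameLargerEnd : Set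
  SameLargerEnd = ∀ e e′ → f e ≡ f e′ → larger e ≡ larger e′

  LocallyBalanced : List (Fin n) → Set
  LocallyBalanced vs = ∀ j {t} → t ∈ cyclicTriples vs → vertexExponent j t ≡ 0ℤ

  injective⇒¬locallyBalanced : (∀ {e e′} → f e ≡ f e′ → e ≡ e′) → ∀ {vs} → IsCircuit vs → ¬ LocallyBalanced vs
  injective⇒¬locallyBalanced _ {_ ∷ []}     (ℕ.s≤s () , _)
  injective⇒¬locallyBalanced _ {_ ∷ _ ∷ []} (ℕ.s≤s (ℕ.s≤s ()) , _)
  injective⇒¬locallyBalanced f-inj {v₁ ∷ v₂ ∷ v₃ ∷ vs} (_ , (v₁≢v₂ ∷ v₁≢v₃ ∷ _) ∷ v₂∉v₃∷vs ∷ _) balanced =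
    unbalancedAt (<-cmp v₁ v₂) (firstTwoTriples v₁ v₂ v₃ vs)
    where
    edge-tail≡ : ∀ {p q p′ q′} {p<q : p Fin.< q} {p′<q′ : p′ Fin.< q′} → f ((p , q) , p<q) ≡ f ((p′ , q′) , p′<q′) → p ≡ p′
    edge-tail≡ = ≡.cong (proj₁ ∘ proj₁) ∘ f-inj

    unbalancedAt : Tri (v₁ Fin.< v₂) (v₁ ≡ v₂) (v₂ Fin.< v₁) → ∃ (λ w → w ∈ v₃ ∷ vs ×
      (w , v₁ , v₂) ∈ cyclicTriples (v₁ ∷ v₂ ∷ v₃ ∷ vs) × (v₁ , v₂ , v₃) ∈ cyclicTriples (v₁ ∷ v₂ ∷ v₃ ∷ vs)) → ⊥
    unbalancedAt (tri≈ _ v₁≡v₂ _) _ = v₁≢v₂ v₁≡v₂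
    unbalancedAt (tri< v₁<v₂ _ _) (_ , _ , _ , second∈) =
      ≡1⇒≢0 (vertexExponent-up v₁<v₂ (λ _ → v₁≢v₃ ∘ ≡.sym ∘ edge-tail≡)) (balanced _ second∈)
    unbalancedAt (tri> _ _ v₂<v₁) (w , w∈v₃∷vs , first∈ , _) =
      ≡-1⇒≢0 (vertexExponent-down v₂<v₁ (λ _ → All.lookup v₂∉v₃∷vs w∈v₃∷vs ∘ ≡.sym ∘ edge-tail≡)) (balanced _ first∈)

  locallyBalanced⇔oscillating : (∀ e e′ → larger e ≡ larger e′ → f e ≡ f e′) →
    ∀ {vs} → IsCircuit vs → LocallyBalanced vs ⇔ Oscillating vs
  locallyBalanced⇔oscillating same {vs} (3≤∣vs∣ , vs-unique) = mk⇔ oscillating locallyBalanced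
    where
    distinct : ∀ {a b} → (a , b) ∈ cyclicPairs vs → a ≢ b
    distinct = cyclicPairs-distinct (ℕ.<⇒≤ 3≤∣vs∣) vs-unique

    oscillating : LocallyBalanced vs → Oscillating vs
    oscillating balanced = All.tabulate λ t∈ →
      [ id , (λ (j , ≢0) → ⊥-elim (≢0 (balanced j t∈))) ]′
        (oscillating⊎vertexExponent≢0 (distinct (∈-cyclicTriples⇒front vs t∈)) (distinct (∈-cyclicTriples⇒back vs t∈)))

    locallyBalanced : Oscillating vs → LocallyBalanced vs
    locallyBalanced osc j t∈ = vertexExponent-oscillating same (All.lookup osc t∈)

-- Balanced circuits

module LabelledCircuits {c ℓ : Level} (A : AbelianGroup c ℓ) {n m : ℕ}
                        (s : Fin m → AbelianGroup.Carrier A) (f : Edge n → Fin m) where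
  open AbelianGroup A
  open Monomials A

  orientedProduct≈monomial : ∀ ps → foldr _∙_ ε (map (orientedLabel group (s ∘ f)) ps) ≈
                                    monomial s (λ j → sumℤ (stepExponent f j) ps)
  orientedProduct≈monomial []       = sym (monomial-zero s (λ _ → ≡.refl))
  orientedProduct≈monomial (e ∷ ps) = trans (∙-congˡ (orientedProduct≈monomial ps)) (sym (monomial-step e _))
    where
    monomial-step : ∀ e x → monomial s (λ j → stepExponent f j e + x j) ≈ orientedLabel group (s ∘ f) e ∙ monomial s x
    monomial-step (p , q) x with <-cmp p q
    ... | tri< p<q _ _    = trans (monomial-cong s (λ j → ≡.cong (_+ x j) (stepExponent-< f p<q)))
                                  (monomial-unit s x (f ((p , q) , p<q)) 1ℤ (λ y → y) (powℤ-suc A))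
    ... | tri≈ _ ≡.refl _ = trans (monomial-cong s (λ j → ≡.trans (≡.cong (_+ x j) (stepExponent-diag f j p)) (ℤ.+-identityˡ (x j))))
                                  (sym (identityˡ _))
    ... | tri> _ _ q<p    = trans (monomial-cong s (λ j → ≡.cong (_+ x j) (stepExponent-> f q<p)))
                                  (monomial-unit s x (f ((q , p) , q<p)) -1ℤ _⁻¹ (powℤ-pred A))

  module _ (same : SameLargerEnd f) {vs : List (Fin n)} (vs-unique : Unique vs) where

    exponent : Fin m → ℤ
    exponent j = sumℤ (stepExponent f j) (cyclicPairs vs)

    exponent≡sum-vertexExponent : ∀ j → exponent j ≡ sumℤ (vertexExponent f j) (cyclicTriples vs)
    exponent≡sum-vertexExponent j = sumℤ-cyclicPairs≡sumℤ-cyclicTriples (ascent f j) vs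

    mid : Fin n × Fin n × Fin n → Fin n
    mid = proj₁ ∘ proj₂

    mids-unique : Unique (map mid (cyclicTriples vs))
    mids-unique = ≡.subst Unique (≡.sym (map-mid-cyclicTriples vs)) vs-unique

    nonzero-at-same-mid : ∀ j t t′ → vertexExponent f j t ≢ 0ℤ → vertexExponent f j t′ ≢ 0ℤ → mid t ≡ mid t′
    nonzero-at-same-mid j (_ , _ , _) (_ , _ , _) ≢0 ≢0′ with vertexExponent-labelled f ≢0 | vertexExponent-labelled f ≢0′
    ... | e , fe≡j , e↑≡v | e′ , fe′≡j , e′↑≡v′ =
      ≡.trans (≡.sym e↑≡v) (≡.trans (same e e′ (≡.trans fe≡j (≡.sym fe′≡j))) e′↑≡v′)

    exponent-trit : ∀ j → Trit (exponent j)
    exponent-trit j = ≡.subst Trit (≡.sym (exponent≡sum-vertexExponent j))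
      (sumℤ-single-support (vertexExponent f j) mid (nonzero-at-same-mid j) {P = Trit} (inj₁ ≡.refl) (vertexExponent-trit f j) mids-unique)

    exponent≡vertexExponent : ∀ j {t} → t ∈ cyclicTriples vs → vertexExponent f j t ≢ 0ℤ → exponent j ≡ vertexExponent f j t
    exponent≡vertexExponent j t∈ ≢0 = ≡.trans (exponent≡sum-vertexExponent j)
      (sumℤ-single (vertexExponent f j) mid (nonzero-at-same-mid j) mids-unique t∈ ≢0)

    balanced⇔locallyBalanced : DistinctSubsetProducts group s → Balanced group (s ∘ f) vs ⇔ LocallyBalanced f vs
    balanced⇔locallyBalanced dsp = mk⇔ locallyBalanced balanced
      where
      locallyBalanced : Balanced group (s ∘ f) vs → LocallyBalanced f vs
      locallyBalanced bal j {t} t∈ with vertexExponent f j t ℤ.≟ 0ℤ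
      ... | yes ≡0 = ≡0
      ... | no ≢0  = ⊥-elim (≢0 (≡.trans (≡.sym (exponent≡vertexExponent j t∈ ≢0)) (exponents≡0 j)))
        where
        exponents≡0 : ∀ j → exponent j ≡ 0ℤ
        exponents≡0 = monomial≈ε⇒≡0 dsp exponent-trit (trans (sym (orientedProduct≈monomial (cyclicPairs vs))) bal)

      balanced : LocallyBalanced f vs → Balanced group (s ∘ f) vs
      balanced ≡0 = trans (orientedProduct≈monomial (cyclicPairs vs))
        (monomial-zero s (λ j → ≡.trans (exponent≡sum-vertexExponent j) (sumℤ-zero (All.tabulate (≡0 j)))))

  injective⇒unbalanced : (∀ {e e′} → f e ≡ f e′ → e ≡ e′) → DistinctSubsetProducts group s →
    ∀ {vs} → IsCircuit vs → ¬ Balanced group (s ∘ f) vs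
  injective⇒unbalanced f-inj dsp circuit@(_ , vs-unique) =
    injective⇒¬locallyBalanced f f-inj circuit ∘ Equivalence.to (balanced⇔locallyBalanced (λ _ _ → ≡.cong larger ∘ f-inj) vs-unique dsp)

  balanced⇔oscillating : (∀ e e′ → (f e ≡ f e′) ⇔ (larger e ≡ larger e′)) → DistinctSubsetProducts group s →
    ∀ {vs} → IsCircuit vs → Balanced group (s ∘ f) vs ⇔ Oscillating vs
  balanced⇔oscillating classes dsp circuit@(_ , vs-unique) =
    locallyBalanced⇔oscillating f (λ e e′ → Equivalence.from (classes e e′)) circuit
      ⇔-∘ balanced⇔locallyBalanced (λ e e′ → Equivalence.to (classes e e′)) vs-unique dsp

mainTheorem4 : ∀ {c ℓ : Level} (n : ℕ) → 1 ≤ n →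
  -- (i) K^u(n) has no balanced circuits
  ((G : Group c ℓ) → IsCyclic G → OrderAtLeast G (2 ^ (n C 2)) →
    (s : Fin (n C 2) → Group.Carrier G) → DistinctSubsetProducts G s →
    (σ : Edge n ⤖ Fin (n C 2)) →
    ∀ (vs : List (Fin n)) → IsCircuit vs →
      ¬ Balanced G (λ e → s (Bijection.to σ e)) vs)
  ×
  -- (ii) balanced circuits of K^o(n) are exactly the oscillating circuits
  ((G : Group c ℓ) → IsCyclic G → OrderAtLeast G (2 ^ (n C 2)) →
    (s : Fin (n C 2) → Group.Carrier G) → DistinctSubsetProducts G s →
    (τ : Edge n → Fin (n C 2)) →
    (∀ e e′ → (τ e ≡ τ e′) ⇔ (larger e ≡ larger e′)) →
    ∀ (vs : List (Fin n)) → IsCircuit vs →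
      Balanced G (λ e → s (τ e)) vs ⇔ Oscillating vs)
  ×
  -- (iii) balanced circuits of K^a(n) are exactly those with a ∣ δ(C)
  (∀ (a : ℕ) (G : Group c ℓ) (g : Group.Carrier G) → Generates G g →
    (∀ (z : ℤ) → Group._≈_ G (powℤ G g z) (Group.ε G) ⇔ ((+ a) ℤd.∣ z)) →
    ∀ (vs : List (Fin n)) → IsCircuit vs →
      Balanced G (λ _ → g) vs ⇔ (a ∣ δ vs))
mainTheorem4 n _ =
    (λ G cyclic _ s dsp σ _ →
       LabelledCircuits.injective⇒unbalanced (cyclicAbelian G cyclic) s (Bijection.to σ) (Bijection.injective σ) dsp)
  , (λ G cyclic _ s dsp τ classes _ →
       LabelledCircuits.balanced⇔oscillating (cyclicAbelian G cyclic) s τ classes dsp)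
  , (λ a G g generates order vs _ →
       balanced⇔order∣δ (abelianGroup G (generator⇒commutative G generates)) a g order vs)
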